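{- Let $G=(K_\ell,G^-)$ be a signed graph whose positive graph is the complete graph $K_\ell$ on its $\ell$ vertices. Then $G$ is balanced chordal if and only if the simple graph $G^-$ is threshold.
   Context: A signed graph $(G^+,G^-)$ consists of simple graphs $G^+$ (positive edges) and $G^-$ (negative edges) on a common finite vertex set. A cycle of length $k\ge3$ is a sequence of distinct vertices $v_1,\dots,v_k$ with edges $\{v_1,v_2\},\dots,\{v_k,v_1\}$, each positive or negative; it is balanced if it has an even number of negative edges. A balanced chord of a balanced cycle is an edge not in the cycle connecting two of its vertices and separating it into two balanced cycles; $G$ is balanced chordal if every balanced cycle of length at least four has a balanced chord. Threshold graphs are defined recursively: $K_1$ is threshold; adding an isolated vertex to a threshold graph gives a threshold graph; adding a dominating vertex (adjacent to all other vertices) to a threshold graph gives a threshold graph. -}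

module Defs where

open import Data.Nat using (ℕ; zero; suc; _+_; _≤_; _<_; _<ᵇ_; _≤ᵇ_; NonZero; _%_)
open import Data.Nat.DivMod using (_mod_)
open import Data.Bool using (Bool; true; false; not; _∧_; if_then_else_)
open import Data.Fin using (Fin; toℕ; punchIn; _≟_)
open import Data.List using (List; length; filterᵇ; allFin)
open import Data.Product using (Σ; Σ-syntax; _×_)
open import Relation.Nullary.Decidable using (⌊_⌋)
open import Relation.Binary.PropositionalEquality using (_≡_; _≢_)
open import Function.Definitions using (Injective)

record SimpleGraph (n : ℕ) : Set where
  field
    adj    : Fin n → Fin n → Bool
    adj-sym    : ∀ u v → adj u v ≡ adj v u
    adj-irrefl : ∀ u → adj u u ≡ false
open SimpleGraph public

complete : (n : ℕ) → SimpleGraph n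
complete n = record
  { adj    = λ u v → not ⌊ u ≟ v ⌋
  ; adj-sym    = symK
  ; adj-irrefl = irreflK
  }
  where
  open import Relation.Binary.PropositionalEquality using (refl; sym)
  open import Relation.Nullary using (yes; no)
  symK : ∀ (u v : Fin n) → not ⌊ u ≟ v ⌋ ≡ not ⌊ v ≟ u ⌋
  symK u v with u ≟ v | v ≟ u
  ... | yes _ | yes _ = refl
  ... | no _  | no _  = refl
  ... | yes p | no q  = Data.Empty.⊥-elim (q (sym p)) where import Data.Empty
  ... | no p  | yes q = Data.Empty.⊥-elim (p (sym q)) where import Data.Empty
  irreflK : ∀ (u : Fin n) → not ⌊ u ≟ u ⌋ ≡ false
  irreflK u with u ≟ u
  ... | yes _ = refl
  ... | no p  = Data.Empty.⊥-elim (p refl) where import Data.Empty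

record SignedGraph (n : ℕ) : Set where
  constructor _,_
  field
    pos : SimpleGraph n
    neg : SimpleGraph n
open SignedGraph public

-- Signs: false = positive edge, true = negative edge.
Sign : Set
Sign = Bool

Edge : ∀ {n} → SignedGraph n → Sign → Fin n → Fin n → Set
Edge G false u v = adj (pos G) u v ≡ true
Edge G true  u v = adj (neg G) u v ≡ true

next : ∀ {k} .{{_ : NonZero k}} → Fin k → Fin k
next {k} i = suc (toℕ i) mod k

record Cycle {n : ℕ} (G : SignedGraph n) (k : ℕ) .{{_ : NonZero k}} : Set where
  field
    length≥3 : 3 ≤ k
    verts    : Fin k → Fin n
    distinct : Injective _≡_ _≡_ verts
    signs    : Fin k → Sign
    edges    : ∀ i → Edge G (signs i) (verts i) (verts (next i))
open Cycle public

negCount : ∀ {n k} {G : SignedGraph n} .{{_ : NonZero k}} →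
           Cycle G k → (ℕ → Bool) → ℕ
negCount {k = k} C p = length (filterᵇ (λ i → p (toℕ i) ∧ signs C i) (allFin k))

signCount : Sign → ℕ
signCount false = 0
signCount true  = 1

Even : ℕ → Set
Even m = m % 2 ≡ 0

Balanced : ∀ {n k} {G : SignedGraph n} .{{_ : NonZero k}} → Cycle G k → Set
Balanced C = Even (negCount C (λ _ → true))

inRange : ℕ → ℕ → ℕ → Bool
inRange a b m = (a ≤ᵇ m) ∧ (m <ᵇ b)

-- A balanced chord: an edge of sign c between v_i and v_j with
-- i + 2 ≤ j and (i , j) ≠ (0 , k-1), i.e. i and j are non-consecutive
-- on the cycle (so the edge is not an edge of the cycle), such that both
-- cycles  v_i … v_j v_i  (cycle edges i … j-1 plus the chord) and
-- v_j … v_{k-1} v_0 … v_i v_j  (the other cycle edges plus the chord)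
-- are balanced.
HasBalancedChord : ∀ {n k} {G : SignedGraph n} .{{_ : NonZero k}} →
                   Cycle G k → Set
HasBalancedChord {k = k} {G} C =
  Σ[ i ∈ Fin k ] Σ[ j ∈ Fin k ] Σ[ c ∈ Sign ]
    ( suc (suc (toℕ i)) ≤ toℕ j
    × suc (toℕ j) < k + toℕ i
    × Edge G c (verts C i) (verts C j)
    × Even (negCount C (inRange (toℕ i) (toℕ j)) + signCount c)
    × Even (negCount C (λ m → not (inRange (toℕ i) (toℕ j) m)) + signCount c) )

BalancedChordal : ∀ {n} → SignedGraph n → Set
BalancedChordal G =
  ∀ (k : ℕ) .{{_ : NonZero k}} → 4 ≤ k →
  (C : Cycle G k) → Balanced C → HasBalancedChord C

delete : ∀ {n} → Fin (suc n) → SimpleGraph (suc n) → SimpleGraph n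
delete p G = record
  { adj    = λ u v → adj G (punchIn p u) (punchIn p v)
  ; adj-sym    = λ u v → adj-sym G (punchIn p u) (punchIn p v)
  ; adj-irrefl = λ u → adj-irrefl G (punchIn p u)
  }

-- Threshold graphs: K_1 is threshold; a graph obtained from a threshold
-- graph by adding an isolated vertex or a dominating vertex is threshold.
-- "Adding vertex p" is expressed as: deleting p leaves a threshold graph
-- and p is isolated / dominating.
data Threshold : ∀ {n} → SimpleGraph n → Set where
  k1         : (G : SimpleGraph 1) → Threshold G
  isolated   : ∀ {n} (G : SimpleGraph (suc n)) (p : Fin (suc n)) →
               Threshold (delete p G) →
               (∀ v → adj G p v ≡ false) → Threshold G
  dominating : ∀ {n} (G : SimpleGraph (suc n)) (p : Fin (suc n)) →
               Threshold (delete p G) →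
               (∀ v → v ≢ p → adj G p v ≡ true) → Threshold G

-- Both conditions are shown equivalent to G⁻ having no alternating 4-cycle
-- (edges ab, cd and non-edges ac, bd, with a ≠ c and b ≠ d).
--  * Threshold ⇔ alternating-free.  An added isolated or dominating vertex
--    cannot lie on an alternating 4-cycle.  Conversely, in an
--    alternating-free graph neighbourhood inclusion is a total preorder;
--    a greatest vertex is dominating, or the vertex it misses is isolated.
--  * Balanced chordal ⇒ alternating-free.  An alternating 4-cycle a b c d,
--    with negative edges ab, cd and positive edges bc, da, is a balanced
--    4-cycle with no balanced chord.
--  * Alternating-free ⇒ balanced chordal.  Every chord of a cycle is
--    available as a positive edge.  A chord is balanced once the arc it cuts
--    off has the right parity, which only depends on the signs of the first
--    four cycle edges when the chord joins two of the first five vertices.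
--    For length ≥ 5 some positive chord of span 2 or 3 works; for length 4
--    the only failing sign pattern is alternating, and then the two opposite
--    negative edges are linked by a negative diagonal.

module Submission where

open import Defs
open import Data.Nat using (ℕ; zero; suc; _+_; _*_; _≤_; _<_; _<ᵇ_; _≤ᵇ_; _%_; s≤s; NonZero)
open import Function.Bundles using (_⇔_; mk⇔)

open import Data.Nat.Properties using (≤ᵇ⇒≤; <⇒≱; <⇒≤; ≤-trans; +-monoˡ-≤; m≤m+n; +-suc)
open import Data.Nat.DivMod using (%-distribˡ-+; [m+kn]%n≡m%n)
open import Data.Nat.Tactic.RingSolver using (solve-∀)
open import Data.Bool using (Bool; true; false; not; _∧_; T)
open import Data.Bool.Properties using (∧-zeroʳ; ¬-not) renaming (_≟_ to _≟ᵇ_)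
open import Data.Fin using (Fin; zero; suc; toℕ; #_; _↑ˡ_; _↑ʳ_; punchIn; _≟_)
open import Data.Fin.Properties using (toℕ<n; <⇒≢; all?; ¬∀⟶∃¬; punchIn-punchOut; punchIn-injective)
open import Data.List using (length; filterᵇ; tabulate)
open import Data.Vec using (Vec; []; _∷_; lookup)
open import Data.Vec.Relation.Unary.AllPairs using ([]; _∷_)
open import Data.Vec.Relation.Unary.All using ([]; _∷_)
open import Data.Vec.Relation.Unary.Unique.Propositional using (Unique)
open import Data.Vec.Relation.Unary.Unique.Propositional.Properties using (lookup-injective)
open import Data.Product using (∃; _×_; _,_)
open import Data.Sum using (_⊎_; inj₁; inj₂; reduce)
open import Data.Empty using (⊥; ⊥-elim)
open import Relation.Binary.Definitions using (Total; Transitive)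
open import Relation.Nullary using (¬_; Dec; yes; no; contradiction)
open import Relation.Nullary.Decidable using (¬?; _→-dec_)
open import Relation.Binary.PropositionalEquality
open import Function using (_∘_; id)

count : ∀ {n} → (Fin n → Bool) → ℕ
count {zero}  f = 0
count {suc n} f = signCount (f zero) + count (f ∘ suc)

count-tabulate : ∀ {A : Set} {n} (P : A → Bool) (f : Fin n → A) →
                 length (filterᵇ P (tabulate f)) ≡ count (P ∘ f)
count-tabulate {n = zero}  P f = refl
count-tabulate {n = suc n} P f with P (f zero)
... | true  = cong suc (count-tabulate P (f ∘ suc))
... | false = count-tabulate P (f ∘ suc)

count-none : ∀ {n} (f : Fin n → Bool) → (∀ i → f i ≡ false) → count f ≡ 0
count-none {zero}  f none = refl
count-none {suc n} f none rewrite none zero = count-none (f ∘ suc) (none ∘ suc)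

count-split : ∀ {n} (p q : Fin n → Bool) →
              count (λ i → p i ∧ q i) + count (λ i → not (p i) ∧ q i) ≡ count q
count-split {zero}  p q = refl
count-split {suc n} p q with p zero | q zero
... | true  | true  = cong suc (count-split (p ∘ suc) (q ∘ suc))
... | true  | false = count-split (p ∘ suc) (q ∘ suc)
... | false | true  = trans (+-suc _ _) (cong suc (count-split (p ∘ suc) (q ∘ suc)))
... | false | false = count-split (p ∘ suc) (q ∘ suc)

count-prefix : ∀ n {m} (f : Fin (n + m) → Bool) → (∀ t → f (n ↑ʳ t) ≡ false) →
               count f ≡ count (f ∘ (_↑ˡ m))
count-prefix zero    f beyond = count-none f beyond
count-prefix (suc n) f beyond =
  cong (signCount (f zero) +_) (count-prefix n (f ∘ suc) beyond)

-- Parity: if x + c and x + y are even, so is y + c.  This transfers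
-- balance from one side of a chord to the other.
even-transfer : ∀ x y c → Even (x + c) → Even (x + y) → Even (y + c)
even-transfer x y c x+c x+y = begin
  (y + c) % 2                       ≡⟨ sym ([m+kn]%n≡m%n (y + c) x 2) ⟩
  (y + c + x * 2) % 2               ≡⟨ cong (_% 2) (rearrange x y c) ⟩
  (x + c + (x + y)) % 2             ≡⟨ %-distribˡ-+ (x + c) (x + y) 2 ⟩
  ((x + c) % 2 + (x + y) % 2) % 2   ≡⟨ cong₂ (λ a b → (a + b) % 2) x+c x+y ⟩
  0                                 ∎
  where
  open ≡-Reasoning
  rearrange : ∀ x y c → y + c + x * 2 ≡ x + c + (x + y)
  rearrange = solve-∀

decide≤ : ∀ {m n} {_ : T (m ≤ᵇ n)} → m ≤ n
decide≤ {m} {n} {m≤ᵇn} = ≤ᵇ⇒≤ m n m≤ᵇn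

negCount-count : ∀ {n k} {G : SignedGraph n} .{{_ : NonZero k}} (C : Cycle G k) (p : ℕ → Bool) →
                 negCount C p ≡ count (λ i → p (toℕ i) ∧ signs C i)
negCount-count C p = count-tabulate (λ i → p (toℕ i) ∧ signs C i) id

negCount-split : ∀ {n k} {G : SignedGraph n} .{{_ : NonZero k}} (C : Cycle G k) (p : ℕ → Bool) →
                 negCount C p + negCount C (λ m → not (p m)) ≡ negCount C (λ _ → true)
negCount-split C p = begin
  negCount C p + negCount C (λ m → not (p m))
    ≡⟨ cong₂ _+_ (negCount-count C p) (negCount-count C (λ m → not (p m))) ⟩
  count (λ i → p (toℕ i) ∧ signs C i) + count (λ i → not (p (toℕ i)) ∧ signs C i)
    ≡⟨ count-split (p ∘ toℕ) (signs C) ⟩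
  count (signs C)
    ≡⟨ sym (negCount-count C (λ _ → true)) ⟩
  negCount C (λ _ → true) ∎
  where open ≡-Reasoning

-- In a balanced cycle, a chord closing a balanced cycle with the arc i … j
-- is a balanced chord: the complementary arc has the same parity.
balancedChord : ∀ {n k} {G : SignedGraph n} .{{_ : NonZero k}} (C : Cycle G k) → Balanced C →
  (i j : Fin k) (c : Sign) → 2 + toℕ i ≤ toℕ j → suc (toℕ j) < k + toℕ i →
  Edge G c (verts C i) (verts C j) →
  Even (negCount C (inRange (toℕ i) (toℕ j)) + signCount c) → HasBalancedChord C
balancedChord C bal i j c i+2≤j j<k+i edge inner =
  i , j , c , i+2≤j , j<k+i , edge , inner ,
  even-transfer (negCount C arc) (negCount C (λ m → not (arc m))) (signCount c)
    inner (subst Even (sym (negCount-split C arc)) bal)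
  where arc = inRange (toℕ i) (toℕ j)

inRange-beyond : ∀ a {b n} → b ≤ n → inRange a b n ≡ false
inRange-beyond a {b} {n} b≤n = trans (cong ((a ≤ᵇ n) ∧_) (<ᵇ-false b≤n)) (∧-zeroʳ (a ≤ᵇ n))
  where
  <ᵇ-false : ∀ {b n} → b ≤ n → (n <ᵇ b) ≡ false
  <ᵇ-false {zero}            _         = refl
  <ᵇ-false {suc b} {suc n} (s≤s b≤n) = <ᵇ-false b≤n

-- Chords among the first five vertices of a cycle of length at least four
-- are governed by the signs s₀ … s₃ of its first four edges.
FirstSigns : ∀ {n m} {G : SignedGraph n} → Cycle G (4 + m) → Sign → Sign → Sign → Sign → Set
FirstSigns C s₀ s₁ s₂ s₃ =
  signs C (# 0) ≡ s₀ × signs C (# 1) ≡ s₁ × signs C (# 2) ≡ s₂ × signs C (# 3) ≡ s₃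

firstNegatives : (ℕ → Bool) → Sign → Sign → Sign → Sign → ℕ
firstNegatives p s₀ s₁ s₂ s₃ = count (λ i → p (toℕ i) ∧ lookup (s₀ ∷ s₁ ∷ s₂ ∷ s₃ ∷ []) i)

negCount-firstFour : ∀ {n m} {G : SignedGraph n} (C : Cycle G (4 + m)) {s₀ s₁ s₂ s₃} →
  FirstSigns C s₀ s₁ s₂ s₃ → (p : ℕ → Bool) → (∀ (t : Fin m) → p (4 + toℕ t) ≡ false) →
  negCount C p ≡ firstNegatives p s₀ s₁ s₂ s₃
negCount-firstFour C (refl , refl , refl , refl) p beyond =
  trans (negCount-count C p)
        (count-prefix 4 (λ i → p (toℕ i) ∧ signs C i) λ t → cong (_∧ signs C (4 ↑ʳ t)) (beyond t))

firstFourChord : ∀ {n m} {G : SignedGraph n} (C : Cycle G (4 + m)) → Balanced C →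
  ∀ {s₀ s₁ s₂ s₃} → FirstSigns C s₀ s₁ s₂ s₃ → (i j : Fin (4 + m)) (c : Sign) →
  2 + toℕ i ≤ toℕ j → toℕ j ≤ 4 → suc (toℕ j) < 4 + m + toℕ i →
  Edge G c (verts C i) (verts C j) →
  Even (firstNegatives (inRange (toℕ i) (toℕ j)) s₀ s₁ s₂ s₃ + signCount c) → HasBalancedChord C
firstFourChord C bal first i j c i+2≤j j≤4 j<k+i edge inner =
  balancedChord C bal i j c i+2≤j j<k+i edge
    (subst (λ x → Even (x + signCount c))
           (sym (negCount-firstFour C first (inRange (toℕ i) (toℕ j)) beyond)) inner)
  where
  beyond : ∀ t → inRange (toℕ i) (toℕ j) (4 + toℕ t) ≡ false
  beyond t = inRange-beyond (toℕ i) (≤-trans j≤4 (m≤m+n 4 (toℕ t)))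

-- Threshold graphs are exactly the graphs without
-- an alternating 4-cycle: edges ab, cd and non-edges ac, bd with a ≠ c, b ≠ d
-- (equivalently, without induced 2K₂, P₄ or C₄).

record Alternating {n} (G : SimpleGraph n) (a b c d : Fin n) : Set where
  constructor alternating
  field
    a≢c : a ≢ c
    b≢d : b ≢ d
    ab  : adj G a b ≡ true
    cd  : adj G c d ≡ true
    ac  : adj G a c ≡ false
    bd  : adj G b d ≡ false

AlternatingFree : ∀ {n} → SimpleGraph n → Set
AlternatingFree G = ∀ {a b c d} → ¬ Alternating G a b c d

not-both : ∀ {b : Bool} → b ≡ true → b ≡ false → ⊥
not-both refl ()

adj-flip : ∀ {n} (G : SimpleGraph n) {u v : Fin n} {b : Bool} → adj G u v ≡ b → adj G v u ≡ b
adj-flip G {u} {v} e = trans (adj-sym G v u) e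

separates : ∀ {n} (G : SimpleGraph n) {u v w : Fin n} →
            adj G u v ≡ true → adj G u w ≡ false → v ≢ w
separates G uv uw refl = not-both uv uw

adjacent-distinct : ∀ {n} (G : SimpleGraph n) {u v : Fin n} → adj G u v ≡ true → u ≢ v
adjacent-distinct G {u} uv u≡v = separates G uv (adj-irrefl G u) (sym u≡v)

alternating-extend : ∀ {n} {G : SimpleGraph (suc n)} {p} {a b c d} →
  Alternating (delete p G) a b c d →
  Alternating G (punchIn p a) (punchIn p b) (punchIn p c) (punchIn p d)
alternating-extend {p = p} (alternating a≢c b≢d ab cd ac bd) =
  alternating (a≢c ∘ punchIn-injective p _ _) (b≢d ∘ punchIn-injective p _ _) ab cd ac bd

alternating-restrict : ∀ {n} {G : SimpleGraph (suc n)} {p} {a b c d a′ b′ c′ d′} →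
  punchIn p a′ ≡ a → punchIn p b′ ≡ b → punchIn p c′ ≡ c → punchIn p d′ ≡ d →
  Alternating G a b c d → Alternating (delete p G) a′ b′ c′ d′
alternating-restrict {p = p} refl refl refl refl (alternating a≢c b≢d ab cd ac bd) =
  alternating (a≢c ∘ cong (punchIn p)) (b≢d ∘ cong (punchIn p)) ab cd ac bd

free-delete : ∀ {n} {G : SimpleGraph (suc n)} (p : Fin (suc n)) →
              AlternatingFree G → AlternatingFree (delete p G)
free-delete p free = free ∘ alternating-extend

free-avoiding : ∀ {n} {G : SimpleGraph (suc n)} {p a b c d} → AlternatingFree (delete p G) →
  p ≢ a → p ≢ b → p ≢ c → p ≢ d → ¬ Alternating G a b c d
free-avoiding free p≢a p≢b p≢c p≢d =
  free ∘ alternating-restrict (punchIn-punchOut p≢a) (punchIn-punchOut p≢b)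
                              (punchIn-punchOut p≢c) (punchIn-punchOut p≢d)

-- Threshold graphs are alternating-free: an added isolated vertex has no
-- edge and an added dominating vertex no non-edge, so neither can lie on an
-- alternating 4-cycle, which therefore lives in the smaller threshold graph.
threshold⇒free : ∀ {n} {G : SimpleGraph n} → Threshold G → AlternatingFree G
threshold⇒free (k1 G) {zero} {_} {zero} alt = Alternating.a≢c alt refl
threshold⇒free (isolated G p T iso) alt =
  free-avoiding (threshold⇒free T)
    (has-edge ab) (has-edge (adj-flip G ab)) (has-edge cd) (has-edge (adj-flip G cd)) alt
  where
  open Alternating alt
  has-edge : ∀ {u v} → adj G u v ≡ true → p ≢ u
  has-edge e refl = not-both e (iso _)
threshold⇒free (dominating G p T dom) alt =
  free-avoiding (threshold⇒free T) (has-non-edge a≢c ac) (has-non-edge b≢d bd)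
    (has-non-edge (a≢c ∘ sym) (adj-flip G ac)) (has-non-edge (b≢d ∘ sym) (adj-flip G bd)) alt
  where
  open Alternating alt
  has-non-edge : ∀ {u v} → u ≢ v → adj G u v ≡ false → p ≢ u
  has-non-edge u≢v e refl = not-both (dom _ (u≢v ∘ sym)) e

linked : ∀ {n} {G : SimpleGraph n} → AlternatingFree G → ∀ {a b c d} → a ≢ c → b ≢ d →
         adj G a b ≡ true → adj G c d ≡ true → adj G a c ≡ true ⊎ adj G b d ≡ true
linked {G = G} free {a} {b} {c} {d} a≢c b≢d ab cd with adj G a c in ac | adj G b d in bd
... | true  | _     = inj₁ refl
... | false | true  = inj₂ refl
... | false | false = ⊥-elim (free (alternating a≢c b≢d ab cd ac bd))

greatest : ∀ {r n} (R : Fin (suc n) → Fin (suc n) → Set r) → Total R → Transitive R →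
           ∃ λ m → ∀ v → R v m
greatest {n = zero}  R R-total R-trans = zero , λ { zero → reduce (R-total zero zero) }
greatest {n = suc n} R R-total R-trans
  with greatest (λ x y → R (suc x) (suc y)) (λ x y → R-total (suc x) (suc y)) R-trans
... | m , m-max with R-total zero (suc m)
...   | inj₁ 0≤m = suc m , λ { zero → 0≤m ; (suc v) → m-max v }
...   | inj₂ m≤0 = zero  , λ { zero → reduce (R-total zero zero) ; (suc v) → R-trans (m-max v) m≤0 }

refute-→ : ∀ {a b} {A : Set a} {B : Set b} → Dec A → ¬ (A → B) → A × ¬ B
refute-→ (yes x) ¬f = x , λ y → ¬f (λ _ → y)
refute-→ (no ¬x) ¬f = ⊥-elim (¬f (λ x → ⊥-elim (¬x x)))

module Domination {n} (G : SimpleGraph n) where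

  _⊑_ : Fin n → Fin n → Set
  u ⊑ v = ∀ y → y ≢ v → adj G u y ≡ true → adj G v y ≡ true

  ⊑-at? : ∀ u v y → Dec (y ≢ v → adj G u y ≡ true → adj G v y ≡ true)
  ⊑-at? u v y = ¬? (y ≟ v) →-dec ((adj G u y ≟ᵇ true) →-dec (adj G v y ≟ᵇ true))

  ⊑-dec : ∀ u v → Dec (u ⊑ v)
  ⊑-dec u v = all? (⊑-at? u v)

  ⋢-witness : ∀ {u v} → ¬ (u ⊑ v) → ∃ λ y → y ≢ v × adj G u y ≡ true × adj G v y ≡ false
  ⋢-witness {u} {v} u⋢v with ¬∀⟶∃¬ n _ (⊑-at? u v) u⋢v
  ... | y , fails with refute-→ (¬? (y ≟ v)) fails
  ...   | y≢v , fails′ with refute-→ (adj G u y ≟ᵇ true) fails′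
  ...     | uy , ¬vy = y , y≢v , uy , ¬-not ¬vy

  ⊑-trans : Transitive _⊑_
  ⊑-trans {u} {v} {w} u⊑v v⊑w y y≢w uy with y ≟ v
  ... | no y≢v = v⊑w y y≢w (u⊑v y y≢v uy)
  ... | yes refl with u ≟ w
  ...   | yes refl = uy
  ...   | no u≢w = adj-flip G (u⊑v w (y≢w ∘ sym) (adj-flip G (v⊑w u u≢w (adj-flip G uy))))

  -- If neither dominates the other, their private neighbours x and y form
  -- the alternating 4-cycle u x y v.
  ⊑-total : AlternatingFree G → Total _⊑_
  ⊑-total free u v with ⊑-dec u v | ⊑-dec v u
  ... | yes u⊑v | _       = inj₁ u⊑v
  ... | no _    | yes v⊑u = inj₂ v⊑u
  ... | no u⋢v  | no v⋢u  with ⋢-witness u⋢v | ⋢-witness v⋢u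
  ...   | x , x≢v , ux , vx | y , y≢u , vy , uy =
    ⊥-elim (free (alternating (y≢u ∘ sym) x≢v ux (adj-flip G vy) uy (adj-flip G vx)))

Dominating : ∀ {n} → SimpleGraph n → Fin n → Set
Dominating G p = ∀ v → v ≢ p → adj G p v ≡ true

Isolated : ∀ {n} → SimpleGraph n → Fin n → Set
Isolated G p = ∀ v → adj G p v ≡ false

dominates-at? : ∀ {n} (G : SimpleGraph n) (p v : Fin n) → Dec (v ≢ p → adj G p v ≡ true)
dominates-at? G p v = ¬? (v ≟ p) →-dec (adj G p v ≟ᵇ true)

misses : ∀ {n} (G : SimpleGraph n) {m : Fin n} → ¬ Dominating G m →
         ∃ λ w → w ≢ m × adj G m w ≡ false
misses {n} G {m} ¬dom with ¬∀⟶∃¬ n _ (dominates-at? G m) ¬dom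
... | w , fails with refute-→ (¬? (w ≟ m)) fails
...   | w≢m , ¬mw = w , w≢m , ¬-not ¬mw

-- If m ⊑-dominates every vertex and misses w ≠ m, then w is isolated:
-- every neighbour z of w would pass w on to m.
missed-isolated : ∀ {n} (G : SimpleGraph n) {m w : Fin n} → (∀ v → Domination._⊑_ G v m) →
                  w ≢ m → adj G m w ≡ false → Isolated G w
missed-isolated G {m} {w} m-max w≢m mw z = ¬-not λ wz → not-both (passes wz) mw
  where
  passes : adj G w z ≡ true → adj G m w ≡ true
  passes wz with z ≟ m
  ... | yes refl = adj-flip G wz
  ... | no z≢m   = m-max z w w≢m (adj-flip G wz)

-- An alternating-free graph has a dominating or an isolated vertex: a
-- ⊑-greatest vertex is dominating, or the vertex it misses is isolated.
dominating-or-isolated : ∀ {n} (G : SimpleGraph (suc n)) → AlternatingFree G →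
  (∃ λ p → Dominating G p) ⊎ (∃ λ p → Isolated G p)
dominating-or-isolated G free
  with greatest (Domination._⊑_ G) (Domination.⊑-total G free) (Domination.⊑-trans G)
... | m , m-max with all? (dominates-at? G m)
...   | yes dom = inj₁ (m , dom)
...   | no ¬dom with misses G ¬dom
...     | w , w≢m , mw = inj₂ (w , missed-isolated G m-max w≢m mw)

free⇒threshold : ∀ n (G : SimpleGraph (suc n)) → AlternatingFree G → Threshold G
free⇒threshold zero    G free = k1 G
free⇒threshold (suc n) G free = peel (dominating-or-isolated G free)
  where
  peel : (∃ λ p → Dominating G p) ⊎ (∃ λ p → Isolated G p) → Threshold G
  peel (inj₁ (p , dom)) = dominating G p (free⇒threshold n (delete p G) (free-delete p free)) dom
  peel (inj₂ (p , iso)) = isolated   G p (free⇒threshold n (delete p G) (free-delete p free)) iso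

complete-adj : ∀ {n} {u v : Fin n} → u ≢ v → adj (complete n) u v ≡ true
complete-adj {u = u} {v} u≢v with u ≟ v
... | yes u≡v = contradiction u≡v u≢v
... | no _    = refl

positive-edge : ∀ {ℓ k} {H : SimpleGraph ℓ} .{{_ : NonZero k}} (C : Cycle (complete ℓ , H) k)
                {i j : Fin k} → i ≢ j → Edge (complete ℓ , H) false (verts C i) (verts C j)
positive-edge C i≢j = complete-adj (i≢j ∘ distinct C)

cycle-edge : ∀ {n k} {G : SignedGraph n} .{{_ : NonZero k}} (C : Cycle G k) {i : Fin k} {s : Sign} →
             signs C i ≡ s → Edge G s (verts C i) (verts C (next i))
cycle-edge C {i} refl = edges C i

square-diagonals : (i j : Fin 4) → 2 + toℕ i ≤ toℕ j → suc (toℕ j) < 4 + toℕ i →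
                   (i ≡ # 0 × j ≡ # 2) ⊎ (i ≡ # 1 × j ≡ # 3)
square-diagonals zero (suc (suc zero))             _ _ = inj₁ (refl , refl)
square-diagonals (suc zero) (suc (suc (suc zero))) _ _ = inj₂ (refl , refl)
square-diagonals zero zero ()
square-diagonals zero (suc zero) (s≤s ())
square-diagonals zero (suc (suc (suc zero))) _ (s≤s (s≤s (s≤s (s≤s ()))))
square-diagonals (suc zero) zero ()
square-diagonals (suc zero) (suc zero) (s≤s ())
square-diagonals (suc zero) (suc (suc zero)) (s≤s (s≤s ()))
square-diagonals (suc (suc i)) j i+2≤j _ =
  ⊥-elim (<⇒≱ (toℕ<n j) (≤-trans (m≤m+n 4 (toℕ i)) i+2≤j))

-- An alternating 4-cycle a b c d of H gives the 4-cycle a b c d of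
-- (K_ℓ , H) with negative edges ab, cd and positive edges bc, da.  It is
-- balanced, yet neither diagonal is a balanced chord: ac and bd are not
-- negative edges, and a positive diagonal cuts off an arc with exactly one
-- negative edge.
module AlternatingSquare {ℓ} {H : SimpleGraph ℓ} {a b c d : Fin ℓ} (alt : Alternating H a b c d) where
  open Alternating alt

  corners : Vec (Fin ℓ) 4
  corners = a ∷ b ∷ c ∷ d ∷ []

  corners-unique : Unique corners
  corners-unique = (adjacent-distinct H ab ∷ a≢c ∷ a≢d ∷ [])
                 ∷ (b≢c ∷ b≢d ∷ []) ∷ (adjacent-distinct H cd ∷ []) ∷ [] ∷ []
    where
    b≢c : b ≢ c
    b≢c = separates H ab ac
    a≢d : a ≢ d
    a≢d a≡d = separates H cd (adj-flip H ac) (sym a≡d)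

  square : Cycle (complete ℓ , H) 4
  square = record
    { length≥3 = decide≤
    ; verts    = lookup corners
    ; distinct = λ {i} {j} → lookup-injective corners-unique i j
    ; signs    = lookup (true ∷ false ∷ true ∷ false ∷ [])
    ; edges    = λ { zero                   → ab
                   ; (suc zero)             → complete-adj (distinct-corners {# 1} {# 2} λ ())
                   ; (suc (suc zero))       → cd
                   ; (suc (suc (suc zero))) → complete-adj (distinct-corners {# 3} {# 0} λ ()) }
    }
    where
    distinct-corners : ∀ {i j} → i ≢ j → lookup corners i ≢ lookup corners j
    distinct-corners i≢j = i≢j ∘ lookup-injective corners-unique _ _

  square-balanced : Balanced square
  square-balanced = refl

  no-balanced-chord : ¬ HasBalancedChord square
  no-balanced-chord (i , j , false , i+2≤j , j<k+i , _ , inner , _) with square-diagonals i j i+2≤j j<k+i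
  ... | inj₁ (refl , refl) = contradiction inner λ ()
  ... | inj₂ (refl , refl) = contradiction inner λ ()
  no-balanced-chord (i , j , true , i+2≤j , j<k+i , negative , _ , _) with square-diagonals i j i+2≤j j<k+i
  ... | inj₁ (refl , refl) = not-both negative ac
  ... | inj₂ (refl , refl) = not-both negative bd

balancedChordal⇒free : ∀ {ℓ} (H : SimpleGraph ℓ) → BalancedChordal (complete ℓ , H) → AlternatingFree H
balancedChordal⇒free H chordal alt = no-balanced-chord (chordal 4 decide≤ square square-balanced)
  where open AlternatingSquare alt

module _ {ℓ} {H : SimpleGraph ℓ} (C : Cycle (complete ℓ , H) 4) (bal : Balanced C)
         {s₀ s₁ s₂ s₃ : Sign} (first : FirstSigns C s₀ s₁ s₂ s₃) where

  diagonal₀₂ : (c : Sign) → Edge (complete ℓ , H) c (verts C (# 0)) (verts C (# 2)) →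
    Even (firstNegatives (inRange 0 2) s₀ s₁ s₂ s₃ + signCount c) → HasBalancedChord C
  diagonal₀₂ c = firstFourChord C bal first (# 0) (# 2) c decide≤ decide≤ decide≤

  diagonal₁₃ : (c : Sign) → Edge (complete ℓ , H) c (verts C (# 1)) (verts C (# 3)) →
    Even (firstNegatives (inRange 1 3) s₀ s₁ s₂ s₃ + signCount c) → HasBalancedChord C
  diagonal₁₃ c = firstFourChord C bal first (# 1) (# 3) c decide≤ decide≤ decide≤

-- If two consecutive edges have equal sign, the
-- positive diagonal spanning them is a balanced chord.  Otherwise the signs
-- alternate, the two negative edges are opposite, and by alternating-freeness
-- they are linked by a negative diagonal, which is a balanced chord.
square-chord : ∀ {ℓ} {H : SimpleGraph ℓ} → AlternatingFree H → (C : Cycle (complete ℓ , H) 4) →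
  Balanced C → ∀ s₀ s₁ s₂ s₃ → FirstSigns C s₀ s₁ s₂ s₃ → HasBalancedChord C
square-chord {H = H} free C bal _ _ _ _ first =
  by-signs _ _ _ _ first (subst Even (negCount-firstFour C first (λ _ → true) λ ()) bal)
  where
  by-signs : ∀ s₀ s₁ s₂ s₃ → FirstSigns C s₀ s₁ s₂ s₃ →
             Even (firstNegatives (λ _ → true) s₀ s₁ s₂ s₃) → HasBalancedChord C
  by-signs true  true  _     _     first _ = diagonal₀₂ C bal first false (positive-edge C λ ()) refl
  by-signs false false _     _     first _ = diagonal₀₂ C bal first false (positive-edge C λ ()) refl
  by-signs true  false false _     first _ = diagonal₁₃ C bal first false (positive-edge C λ ()) refl
  by-signs false true  true  _     first _ = diagonal₁₃ C bal first false (positive-edge C λ ()) refl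
  by-signs true  false true  true  _     ()
  by-signs false true  false false _     ()
  by-signs true  false true  false first@(e₀ , _ , e₂ , _) _
    with linked free ((λ ()) ∘ distinct C) ((λ ()) ∘ distinct C) (cycle-edge C e₀) (cycle-edge C e₂)
  ... | inj₁ v₀v₂ = diagonal₀₂ C bal first true v₀v₂ refl
  ... | inj₂ v₁v₃ = diagonal₁₃ C bal first true v₁v₃ refl
  by-signs false true  false true  first@(_ , e₁ , _ , e₃) _
    with linked free ((λ ()) ∘ distinct C) ((λ ()) ∘ distinct C) (cycle-edge C e₁) (cycle-edge C e₃)
  ... | inj₁ v₁v₃ = diagonal₁₃ C bal first true v₁v₃ refl
  ... | inj₂ v₂v₀ = diagonal₀₂ C bal first true (adj-flip H v₂v₀) refl

-- A chord spanning at most three edges is not a cycle edge when k ≥ 5.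
short-fits : ∀ m {i j} → j ≤ 3 + i → suc j < 5 + m + i
short-fits m {i} j≤i+3 = ≤-trans (s≤s (s≤s j≤i+3)) (+-monoˡ-≤ i (m≤m+n 5 m))

short-chord : ∀ {ℓ m} {H : SimpleGraph ℓ} (C : Cycle (complete ℓ , H) (5 + m)) → Balanced C →
  ∀ {s₀ s₁ s₂ s₃} → FirstSigns C s₀ s₁ s₂ s₃ → (i j : Fin (5 + m)) →
  {_ : T (2 + toℕ i ≤ᵇ toℕ j)} {_ : T (toℕ j ≤ᵇ 3 + toℕ i)} {_ : T (toℕ j ≤ᵇ 4)} →
  Even (firstNegatives (inRange (toℕ i) (toℕ j)) s₀ s₁ s₂ s₃ + 0) → HasBalancedChord C
short-chord {m = m} C bal first i j {i+2≤j} {j≤i+3} {j≤4} =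
  firstFourChord C bal first i j false (≤ᵇ⇒≤ _ _ i+2≤j) (≤ᵇ⇒≤ _ _ j≤4)
    (short-fits m (≤ᵇ⇒≤ _ _ j≤i+3)) (positive-edge C (<⇒≢ (<⇒≤ (≤ᵇ⇒≤ _ _ i+2≤j))))

-- Among the first four signs,
-- some window of two or three consecutive edges has an even number of
-- negative edges; the positive chord spanning it joins two of the first five
-- vertices, is not a cycle edge, and is a balanced chord.
long-cycle-chord : ∀ {ℓ m} {H : SimpleGraph ℓ} (C : Cycle (complete ℓ , H) (5 + m)) → Balanced C →
  ∀ s₀ s₁ s₂ s₃ → FirstSigns C s₀ s₁ s₂ s₃ → HasBalancedChord C
long-cycle-chord C bal true  true  _     _     first = short-chord C bal first (# 0) (# 2) refl
long-cycle-chord C bal false false _     _     first = short-chord C bal first (# 0) (# 2) refl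
long-cycle-chord C bal true  false false _     first = short-chord C bal first (# 1) (# 3) refl
long-cycle-chord C bal false true  true  _     first = short-chord C bal first (# 1) (# 3) refl
long-cycle-chord C bal true  false true  true  first = short-chord C bal first (# 2) (# 4) refl
long-cycle-chord C bal false true  false false first = short-chord C bal first (# 2) (# 4) refl
long-cycle-chord C bal true  false true  false first = short-chord C bal first (# 0) (# 3) refl
long-cycle-chord C bal false true  false true  first = short-chord C bal first (# 1) (# 4) refl

free⇒balancedChordal : ∀ {ℓ} (H : SimpleGraph ℓ) → AlternatingFree H → BalancedChordal (complete ℓ , H)
free⇒balancedChordal H free 4 _ C bal =
  square-chord free C bal _ _ _ _ (refl , refl , refl , refl)
free⇒balancedChordal H free (suc (suc (suc (suc (suc m))))) _ C bal =
  long-cycle-chord C bal _ _ _ _ (refl , refl , refl , refl)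
free⇒balancedChordal H free 0 ()
free⇒balancedChordal H free 1 (s≤s ())
free⇒balancedChordal H free 2 (s≤s (s≤s ()))
free⇒balancedChordal H free 3 (s≤s (s≤s (s≤s ())))

proposition6p2 : (ℓ : ℕ) → 1 ≤ ℓ → (Gneg : SimpleGraph ℓ) →
    BalancedChordal (complete ℓ , Gneg) ⇔ Threshold Gneg
proposition6p2 (suc n) _ Gneg =
  mk⇔ (free⇒threshold n Gneg ∘ balancedChordal⇒free Gneg)
      (free⇒balancedChordal Gneg ∘ threshold⇒free)
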